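{- (1) $\mathbf{il}^-(\mathbf{J1}^u,\mathbf{I3})\vdash \mathbf{J15}^u$. (2) $\mathbf{il}^-(\mathbf{J15}^u)\vdash \mathbf{J1}^u$. (3) $\mathbf{il}^-(\mathbf{J15}^u)\vdash \mathbf{I}\Box\bot$. (4) $\mathbf{il}^-(\mathbf{I1},\mathbf{I2})\vdash \mathbf{J15}^u$. (5) $\mathbf{il}^-(\mathbf{I2})\vdash \mathbf{I4}$. (6) $\mathbf{il}\vdash \Box\bot\leftrightarrow\mathbf{I}\bot$. (7) $\mathbf{il}$ is closed under the rule: from $A\to B$ infer $\mathbf{I}A\to\mathbf{I}B$. (Here $\ell\vdash\Sigma$ for a schema $\Sigma$ means $\ell$ proves every instance of $\Sigma$.)
   Context: The language $\mathcal{L}(\Box,\mathbf{I})$ has propositional variables, $\bot$, $\to$, and unary modal operators $\Box$ and $\mathbf{I}$; other connectives as usual, $\Diamond A:\equiv\neg\Box\neg A$. The logic $\mathbf{il}^-$ has as axioms all tautologies of $\mathcal{L}(\Box,\mathbf{I})$, $\Box(A\to B)\to(\Box A\to\Box B)$, $\Box(\Box A\to A)\to\Box A$, and $\Box\bot\leftrightarrow\mathbf{I}\bot$; rules: Modus Ponens, Necessitation, and from $A\to B$ infer $\mathbf{I}A\to\mathbf{I}B$. Schemata: $\mathbf{I1}$: $\mathbf{I}\Box\bot$; $\mathbf{I2}$: $\Box(A\to B)\to(\mathbf{I}A\to\mathbf{I}B)$; $\mathbf{I3}$: $\mathbf{I}(A\lor\Diamond A)\to\mathbf{I}A$; $\mathbf{I4}$: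 $\mathbf{I}A\land\Diamond\top\to\Diamond A$; $\mathbf{J1}^u$: $\Box A\to\mathbf{I}A$; $\mathbf{J15}^u$: $\Box(A\lor\Diamond A)\to\mathbf{I}A$. $\mathbf{il}^-(\Sigma_1,\dots,\Sigma_k)$ is $\mathbf{il}^-$ with the schemata $\Sigma_i$ added as axioms. De Rijke's logic $\mathbf{il}$ has as axioms all tautologies of $\mathcal{L}(\Box,\mathbf{I})$, $\Box(A\to B)\to(\Box A\to\Box B)$, $\Box(\Box A\to A)\to\Box A$, $\mathbf{I1}$, $\mathbf{I2}$, $\mathbf{I3}$, $\mathbf{I4}$; its rules are Modus Ponens and Necessitation only. -}

module Defs where

open import Data.Nat using (ℕ)
open import Data.Bool using (Bool; true; false; not; _∧_; _∨_)
open import Data.Product using (∃; _×_; _,_)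
open import Data.Sum using (_⊎_)
open import Relation.Binary.PropositionalEquality using (_≡_)
open import Level using (0ℓ)
open import Relation.Unary using (Pred)

data Fm : Set where
  var  : ℕ → Fm
  ⊥'   : Fm
  _⇒_  : Fm → Fm → Fm
  □_   : Fm → Fm
  I_   : Fm → Fm

infixr 5 _⇒_
infix 9 □_ I_

¬'_ : Fm → Fm
¬' A = A ⇒ ⊥'

⊤' : Fm
⊤' = ¬' ⊥'

_∨'_ : Fm → Fm → Fm
A ∨' B = (¬' A) ⇒ B

_∧'_ : Fm → Fm → Fm
A ∧' B = ¬' (A ⇒ ¬' B)

_⇔_ : Fm → Fm → Fm
A ⇔ B = (A ⇒ B) ∧' (B ⇒ A)

◇_ : Fm → Fm
◇ A = ¬' (□ (¬' A))

infix 9 ¬'_ ◇_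
infixl 7 _∧'_
infixl 6 _∨'_
infix 4 _⇔_

-- Tautologies: formulas true under every Boolean valuation in which
-- propositional variables and modalised formulas (□A, IA) are atoms.
record Valuation : Set where
  field
    vVar : ℕ → Bool
    vBox : Fm → Bool
    vI   : Fm → Bool

eval : Valuation → Fm → Bool
eval v (var n) = Valuation.vVar v n
eval v ⊥'      = false
eval v (A ⇒ B) = not (eval v A) ∨ eval v B
eval v (□ A)   = Valuation.vBox v A
eval v (I A)   = Valuation.vI v A

Tautology : Fm → Set
Tautology A = (v : Valuation) → eval v A ≡ true

Schema : Set₁
Schema = Pred Fm 0ℓ

_∪_ : Schema → Schema → Schema
(S ∪ T) A = S A ⊎ T A

∅ : Schema
∅ _ = Data.Empty.⊥ where import Data.Empty

I1 : Schema
I1 A = A ≡ I (□ ⊥')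

I2 : Schema
I2 C = ∃ λ A → ∃ λ B → C ≡ (□ (A ⇒ B) ⇒ (I A ⇒ I B))

I3 : Schema
I3 C = ∃ λ A → C ≡ (I (A ∨' ◇ A) ⇒ I A)

I4 : Schema
I4 C = ∃ λ A → C ≡ ((I A ∧' ◇ ⊤') ⇒ ◇ A)

J1u : Schema
J1u C = ∃ λ A → C ≡ (□ A ⇒ I A)

J15u : Schema
J15u C = ∃ λ A → C ≡ (□ (A ∨' ◇ A) ⇒ I A)

data ILm (Σ : Schema) : Fm → Set where
  taut : ∀ {A} → Tautology A → ILm Σ A
  K    : ∀ {A B} → ILm Σ (□ (A ⇒ B) ⇒ (□ A ⇒ □ B))
  Löb  : ∀ {A} → ILm Σ (□ (□ A ⇒ A) ⇒ □ A)
  boxI : ILm Σ (□ ⊥' ⇔ I ⊥')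
  ax   : ∀ {A} → Σ A → ILm Σ A
  mp   : ∀ {A B} → ILm Σ (A ⇒ B) → ILm Σ A → ILm Σ B
  nec  : ∀ {A} → ILm Σ A → ILm Σ (□ A)
  Irule : ∀ {A B} → ILm Σ (A ⇒ B) → ILm Σ (I A ⇒ I B)

data IL : Fm → Set where
  taut : ∀ {A} → Tautology A → IL A
  K    : ∀ {A B} → IL (□ (A ⇒ B) ⇒ (□ A ⇒ □ B))
  Löb  : ∀ {A} → IL (□ (□ A ⇒ A) ⇒ □ A)
  i1   : ∀ {A} → I1 A → IL A
  i2   : ∀ {A} → I2 A → IL A
  i3   : ∀ {A} → I3 A → IL A
  i4   : ∀ {A} → I4 A → IL A
  mp   : ∀ {A B} → IL (A ⇒ B) → IL A → IL B
  nec  : ∀ {A} → IL A → IL (□ A)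

_⊢ˢ_ : (Fm → Set) → Schema → Set
L ⊢ˢ S = ∀ A → S A → L A

infix 2 _⊢ˢ_

-- Beyond propositional and normal modal reasoning, two facts carry the argument:
-- □(A ∨ ◇A) implies □(□⊥ → A), which I1 and I2 turn into IA; and I⊥ implies □⊥, that is
-- ¬◇⊤, so that by I2 the necessity of ¬A makes IA refute ◇⊤, which is I4.
module Submission where

open import Defs
open import Data.Bool using (true; false)
open import Data.Product using (_×_; _,_)
open import Data.Sum using (inj₁; inj₂)
open import Function using (id; _∘_)
open import Relation.Binary.PropositionalEquality using (refl)
open import Relation.Unary using (_⊆_)

variable A B C : Fm

-- The formula arguments are explicit: Tautology A computes through eval, so A cannot be
-- inferred from it.
module Taut where

  ⇒-trans : ∀ A B C → Tautology ((A ⇒ B) ⇒ (B ⇒ C) ⇒ A ⇒ C)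
  ⇒-trans A B C v with eval v A | eval v B | eval v C
  ... | false | false | false = refl
  ... | false | false | true  = refl
  ... | false | true  | false = refl
  ... | false | true  | true  = refl
  ... | true  | false | false = refl
  ... | true  | false | true  = refl
  ... | true  | true  | false = refl
  ... | true  | true  | true  = refl

  modus-ponens : ∀ A B → Tautology (A ⇒ (A ⇒ B) ⇒ B)
  modus-ponens A B v with eval v A | eval v B
  ... | false | _     = refl
  ... | true  | false = refl
  ... | true  | true  = refl

  ex-falso : ∀ A → Tautology (⊥' ⇒ A)
  ex-falso _ _ = refl

  ∨-introˡ : ∀ A B → Tautology (A ⇒ A ∨' B)
  ∨-introˡ A _ v with eval v A
  ... | false = refl
  ... | true  = refl

  contraposition : ∀ A B → Tautology ((A ⇒ B) ⇒ ¬' B ⇒ ¬' A)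
  contraposition A B v with eval v A | eval v B
  ... | false | false = refl
  ... | false | true  = refl
  ... | true  | false = refl
  ... | true  | true  = refl

  contraposition⁻ : ∀ A B → Tautology ((¬' A ⇒ ¬' B) ⇒ B ⇒ A)
  contraposition⁻ A B v with eval v A | eval v B
  ... | false | false = refl
  ... | false | true  = refl
  ... | true  | false = refl
  ... | true  | true  = refl

  ⇔-intro : ∀ A B → Tautology ((A ⇒ B) ⇒ (B ⇒ A) ⇒ (A ⇔ B))
  ⇔-intro A B v with eval v A | eval v B
  ... | false | false = refl
  ... | false | true  = refl
  ... | true  | false = refl
  ... | true  | true  = refl

  ⇔-elimʳ : ∀ A B → Tautology ((A ⇔ B) ⇒ B ⇒ A)
  ⇔-elimʳ A B v with eval v A | eval v B
  ... | false | false = refl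
  ... | false | true  = refl
  ... | true  | false = refl
  ... | true  | true  = refl

  curry-contraposition : ∀ A B C → Tautology ((A ∧' ¬' B ⇒ ¬' C) ⇒ C ⇒ A ⇒ B)
  curry-contraposition A B C v with eval v A | eval v B | eval v C
  ... | false | false | false = refl
  ... | false | false | true  = refl
  ... | false | true  | false = refl
  ... | false | true  | true  = refl
  ... | true  | false | false = refl
  ... | true  | false | true  = refl
  ... | true  | true  | false = refl
  ... | true  | true  | true  = refl

  uncurry-contraposition : ∀ A B C → Tautology ((A ⇒ B ⇒ C) ⇒ B ∧' ¬' C ⇒ ¬' A)
  uncurry-contraposition A B C v with eval v A | eval v B | eval v C
  ... | false | false | false = refl
  ... | false | false | true  = refl
  ... | false | true  | false = refl
  ... | false | true  | true  = refl
  ... | true  | false | false = refl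
  ... | true  | false | true  = refl
  ... | true  | true  | false = refl
  ... | true  | true  | true  = refl

module Derivations
  (L : Fm → Set)
  (⊢taut : ∀ {A} → Tautology A → L A)
  (⊢mp   : ∀ {A B} → L (A ⇒ B) → L A → L B)
  (⊢nec  : ∀ {A} → L A → L (□ A))
  (⊢K    : ∀ {A B} → L (□ (A ⇒ B) ⇒ □ A ⇒ □ B))
  (⊢Löb  : ∀ {A} → L (□ (□ A ⇒ A) ⇒ □ A))
  where

  ⇒-trans : L (A ⇒ B) → L (B ⇒ C) → L (A ⇒ C)
  ⇒-trans {A} {B} {C} A⇒B B⇒C = ⊢mp (⊢mp (⊢taut (Taut.⇒-trans A B C)) A⇒B) B⇒C

  ⇒-trans-antecedent : L (A ⇒ B) → L ((B ⇒ C) ⇒ A ⇒ C)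
  ⇒-trans-antecedent {A} {B} {C} = ⊢mp (⊢taut (Taut.⇒-trans A B C))

  ⇒-discharge : L (A ⇒ B ⇒ C) → L B → L (A ⇒ C)
  ⇒-discharge {A} {B} {C} A⇒B⇒C b = ⇒-trans A⇒B⇒C (⊢mp (⊢taut (Taut.modus-ponens B C)) b)

  ⇒-trans-consequent : L (B ⇒ C) → L ((A ⇒ B) ⇒ A ⇒ C)
  ⇒-trans-consequent {B} {C} {A} = ⇒-discharge (⊢taut (Taut.⇒-trans A B C))

  ⇔-intro : L (A ⇒ B) → L (B ⇒ A) → L (A ⇔ B)
  ⇔-intro {A} {B} A⇒B B⇒A = ⊢mp (⊢mp (⊢taut (Taut.⇔-intro A B)) A⇒B) B⇒A

  ⇔-elimʳ : L (A ⇔ B) → L (B ⇒ A)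
  ⇔-elimʳ {A} {B} = ⊢mp (⊢taut (Taut.⇔-elimʳ A B))

  □-mono : L (A ⇒ B) → L (□ A ⇒ □ B)
  □-mono = ⊢mp ⊢K ∘ ⊢nec

  □⊥⇒□A : L (□ ⊥' ⇒ □ A)
  □⊥⇒□A {A} = □-mono (⊢taut (Taut.ex-falso A))

  □[□⊥⇒A]⇒IA : L ⊢ˢ I1 → L ⊢ˢ I2 → L (□ (□ ⊥' ⇒ A) ⇒ I A)
  □[□⊥⇒A]⇒IA {A} ⊢I1 ⊢I2 = ⇒-discharge (⊢I2 _ (□ ⊥' , A , refl)) (⊢I1 _ refl)

  J1u∧I3⇒J15u : L ⊢ˢ J1u → L ⊢ˢ I3 → L ⊢ˢ J15u
  J1u∧I3⇒J15u ⊢J1u ⊢I3 _ (A , refl) = ⇒-trans (⊢J1u _ (A ∨' ◇ A , refl)) (⊢I3 _ (A , refl))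

  J15u⇒J1u : L ⊢ˢ J15u → L ⊢ˢ J1u
  J15u⇒J1u ⊢J15u _ (A , refl) =
    ⇒-trans (□-mono (⊢taut (Taut.∨-introˡ A (◇ A)))) (⊢J15u _ (A , refl))

  -- □⊥ ∨ ◇□⊥ is the contrapositive of Löb's axiom for ⊥.
  J15u⇒I□⊥ : L ⊢ˢ J15u → L (I (□ ⊥'))
  J15u⇒I□⊥ ⊢J15u =
    ⊢mp (⊢J15u _ (□ ⊥' , refl)) (⊢nec (⊢mp (⊢taut (Taut.contraposition (□ ¬' □ ⊥') (□ ⊥'))) ⊢Löb))

  I1∧I2⇒J15u : L ⊢ˢ I1 → L ⊢ˢ I2 → L ⊢ˢ J15u
  I1∧I2⇒J15u ⊢I1 ⊢I2 _ (A , refl) = ⇒-trans □[A∨◇A]⇒□[□⊥⇒A] (□[□⊥⇒A]⇒IA ⊢I1 ⊢I2)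
    where
    □[A∨◇A]⇒□[□¬A⇒A] : L (□ (A ∨' ◇ A) ⇒ □ (□ ¬' A ⇒ A))
    □[A∨◇A]⇒□[□¬A⇒A] = □-mono (⊢taut (Taut.contraposition⁻ A (□ ¬' A)))

    □[A∨◇A]⇒□[□⊥⇒A] : L (□ (A ∨' ◇ A) ⇒ □ (□ ⊥' ⇒ A))
    □[A∨◇A]⇒□[□⊥⇒A] = ⇒-trans □[A∨◇A]⇒□[□¬A⇒A] (□-mono (⇒-trans-antecedent □⊥⇒□A))

  -- With ◇⊤ = ¬□¬⊤, I4 is the contrapositive of □¬A ⇒ IA ⇒ □¬⊤.
  I2⇒I4 : L (□ ⊥' ⇔ I ⊥') → L ⊢ˢ I2 → L ⊢ˢ I4
  I2⇒I4 □⊥⇔I⊥ ⊢I2 _ (A , refl) =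
    ⊢mp (⊢taut (Taut.uncurry-contraposition (□ ¬' A) (I A) (□ ¬' ⊤'))) □¬A⇒IA⇒□¬⊤
    where
    I⊥⇒□¬⊤ : L (I ⊥' ⇒ □ ¬' ⊤')
    I⊥⇒□¬⊤ = ⇒-trans (⇔-elimʳ □⊥⇔I⊥) □⊥⇒□A

    □¬A⇒IA⇒□¬⊤ : L (□ ¬' A ⇒ I A ⇒ □ ¬' ⊤')
    □¬A⇒IA⇒□¬⊤ = ⇒-trans (⊢I2 _ (A , ⊥' , refl)) (⇒-trans-consequent I⊥⇒□¬⊤)

  I1∧I2∧I4⇒□⊥⇔I⊥ : L ⊢ˢ I1 → L ⊢ˢ I2 → L ⊢ˢ I4 → L (□ ⊥' ⇔ I ⊥')
  I1∧I2∧I4⇒□⊥⇔I⊥ ⊢I1 ⊢I2 ⊢I4 =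
    ⇔-intro (⇒-trans □⊥⇒□A (□[□⊥⇒A]⇒IA ⊢I1 ⊢I2)) (⇒-trans I⊥⇒□¬⊤ (□-mono (⊢taut λ _ → refl)))
    where
    -- I4 for A = ⊥ reads I⊥ ∧ ◇⊤ ⇒ ¬□⊤.
    I⊥⇒□¬⊤ : L (I ⊥' ⇒ □ ¬' ⊤')
    I⊥⇒□¬⊤ = ⊢mp (⊢mp (⊢taut (Taut.curry-contraposition (I ⊥') (□ ¬' ⊤') (□ ⊤'))) (⊢I4 _ (⊥' , refl)))
                 (⊢nec (⊢taut λ _ → refl))

  I2⇒I-rule : L ⊢ˢ I2 → L (A ⇒ B) → L (I A ⇒ I B)
  I2⇒I-rule {A} {B} ⊢I2 A⇒B = ⊢mp (⊢I2 _ (A , B , refl)) (⊢nec A⇒B)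

module ILm-derivations {Σ : Schema} = Derivations (ILm Σ) taut mp nec K Löb
module IL-derivations = Derivations IL taut mp nec K Löb

ILm-axioms : ∀ {Σ S} → S ⊆ Σ → ILm Σ ⊢ˢ S
ILm-axioms S⊆Σ _ = ax ∘ S⊆Σ

proposition3p8 :
    (ILm (J1u ∪ I3) ⊢ˢ J15u)
    × (ILm J15u ⊢ˢ J1u)
    × ILm J15u (I (□ ⊥'))
    × (ILm (I1 ∪ I2) ⊢ˢ J15u)
    × (ILm I2 ⊢ˢ I4)
    × IL (□ ⊥' ⇔ I ⊥')
    × (∀ A B → IL (A ⇒ B) → IL (I A ⇒ I B))
proposition3p8 =
    J1u∧I3⇒J15u (ILm-axioms inj₁) (ILm-axioms inj₂)
  , J15u⇒J1u (ILm-axioms id)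
  , J15u⇒I□⊥ (ILm-axioms id)
  , I1∧I2⇒J15u (ILm-axioms inj₁) (ILm-axioms inj₂)
  , I2⇒I4 boxI (ILm-axioms id)
  , IL-derivations.I1∧I2∧I4⇒□⊥⇔I⊥ (λ _ → i1) (λ _ → i2) (λ _ → i4)
  , λ _ _ → IL-derivations.I2⇒I-rule (λ _ → i2)
  where open ILm-derivations
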